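{- Let $q<p$ be primes. Then there exists $D_p(q)\in\mathbb{N}\cup\{0\}$ such that every $N\in N_1$ all of whose prime factors are less than $p$ satisfies $v_q(N)\le D_p(q)$.
   Context: $\phi$ is Euler's totient function, $V$ its image; for $m\in V$, $N_1(m)=\max\{x\in\mathbb{N}:\phi(x)\le m\}$ and $N_1=\{N_1(m):m\in V\}$. For a prime $q$ and nonzero integer $n$, $v_q(n)$ is the largest $r\ge0$ with $q^r\mid n$. -}

module Defs where

open import Data.Nat using (ℕ; suc; _≤_; _<_; _^_)
open import Data.Nat.GCD using (gcd)
open import Data.Nat.Divisibility using (_∣_)
open import Data.Nat.Primality using (Prime)
open import Data.Nat.Properties using (_≟_)
open import Data.List using (List; length; filter; map; upTo)
open import Data.Product using (_×_; ∃-syntax)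
open import Relation.Binary.PropositionalEquality using (_≡_)

-- Euler's totient: φ n = #{ k : 1 ≤ k ≤ n , gcd k n = 1 }  (φ 0 = 0, harmless)
φ : ℕ → ℕ
φ n = length (filter (λ k → gcd k n ≟ 1) (map suc (upTo n)))

InV : ℕ → Set
InV m = ∃[ y ] (1 ≤ y × φ y ≡ m)

IsN₁ : ℕ → ℕ → Set
IsN₁ m N = φ N ≤ m × (∀ x → φ x ≤ m → x ≤ N)

InN₁ : ℕ → Set
InN₁ N = ∃[ m ] (InV m × IsN₁ m N)

IsValuation : ℕ → ℕ → ℕ → Set
IsValuation q n r = (q ^ r) ∣ n × (∀ s → (q ^ s) ∣ n → s ≤ r)

{-# OPTIONS --safe #-}
-- Suppose v_q(N) > c := (p − 1)², so N = q^c K with q ∣ K; then φ(N) = q^c φ(K). Since p ∤ N,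
-- φ(pK) ≤ (p − 1) φ(K), so taking y with y (p − 1) ≤ q^c < y p, the number x = y p K satisfies
-- φ(x) ≤ y φ(pK) ≤ q^c φ(K) = φ(N) although x > N, contradicting the maximality of N.
-- Such a y exists because q^c ≥ (p − 1)². All estimates on φ come from counting, period by
-- period, the integers coprime to a modulus.
module Submission where

open import Defs
open import Data.Bool using (true; false; if_then_else_)
open import Data.List using (length; filter; applyUpTo)
open import Data.List.Properties using (map-upTo)
open import Data.Nat
open import Data.Nat.Coprimality using (Coprime; coprime⇒gcd≡1; gcd≡1⇒coprime; coprime-+; coprime-divisor)
  renaming (sym to coprime-sym)
open import Data.Nat.DivMod using (_/_; _%_; m≡m%n+[m/n]*n; m%n<n; m*n/n≡m; m/n*n≤m; /-monoˡ-≤)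
open import Data.Nat.Divisibility
open import Data.Nat.GCD using (gcd)
open import Data.Nat.Primality using (Prime; prime⇒irreducible; prime⇒nonTrivial; prime⇒nonZero)
open import Data.Nat.Properties
open import Algebra.Properties.CommutativeSemigroup +-commutativeSemigroup using (interchange)
open import Data.Product using (∃-syntax; _×_; _,_)
open import Data.Sum using (inj₁; inj₂)
open import Function using (_∘_)
open import Relation.Nullary using (¬_; Dec; yes; no; does; contradiction)
open import Relation.Unary using (Pred; Decidable)
open import Relation.Binary.PropositionalEquality

private variable
  k k′ m n n′ q : ℕ

sumBelow : (ℕ → ℕ) → ℕ → ℕ
sumBelow f zero    = 0
sumBelow f (suc n) = f 0 + sumBelow (f ∘ suc) n

sumBelow-cong : ∀ {f g} n → (∀ i → f i ≡ g i) → sumBelow f n ≡ sumBelow g n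
sumBelow-cong zero    f≗g = refl
sumBelow-cong (suc n) f≗g = cong₂ _+_ (f≗g 0) (sumBelow-cong n (f≗g ∘ suc))

sumBelow-mono-≤ : ∀ {f g} n → (∀ i → f i ≤ g i) → sumBelow f n ≤ sumBelow g n
sumBelow-mono-≤ zero    f≤g = z≤n
sumBelow-mono-≤ (suc n) f≤g = +-mono-≤ (f≤g 0) (sumBelow-mono-≤ n (f≤g ∘ suc))

sumBelow-+ : ∀ f m n → sumBelow f (m + n) ≡ sumBelow f m + sumBelow (λ i → f (m + i)) n
sumBelow-+ f zero    n = refl
sumBelow-+ f (suc m) n = trans (cong (f 0 +_) (sumBelow-+ (f ∘ suc) m n)) (sym (+-assoc (f 0) _ _))

sumBelow-suc : ∀ f n → sumBelow f (suc n) ≡ sumBelow f n + f n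
sumBelow-suc f zero    = +-comm (f 0) 0
sumBelow-suc f (suc n) = trans (cong (f 0 +_) (sumBelow-suc (f ∘ suc) n)) (sym (+-assoc (f 0) _ _))

sumBelow-periodic : ∀ f n → (∀ i → f (n + i) ≡ f i) → ∀ y → sumBelow f (y * n) ≡ y * sumBelow f n
sumBelow-periodic f n periodic zero    = refl
sumBelow-periodic f n periodic (suc y) = trans (sumBelow-+ f n (y * n))
  (cong (sumBelow f n +_) (trans (sumBelow-cong (y * n) periodic) (sumBelow-periodic f n periodic y)))

-- J * suc p + p is the last index of the J-th block of length p + 1.
sumBelow-blocks : ∀ {g h e : ℕ → ℕ} p → (∀ i → g i ≤ h i) →
  (∀ J → g (J * suc p + p) ≡ 0) → (∀ J → h (J * suc p + p) ≡ e J) →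
  ∀ J → sumBelow g (J * suc p) + sumBelow e J ≤ sumBelow h (J * suc p)
sumBelow-blocks p g≤h g-last h-last zero = z≤n
sumBelow-blocks {g} {h} {e} p g≤h g-last h-last (suc J) = begin
  sumBelow g (suc p + J * suc p) + sumBelow e (suc J)
    ≡⟨ cong (_+ sumBelow e (suc J)) (sumBelow-+ g (suc p) (J * suc p)) ⟩
  (sumBelow g (suc p) + sumBelow g′ (J * suc p)) + (e 0 + sumBelow (e ∘ suc) J)
    ≡⟨ interchange (sumBelow g (suc p)) _ (e 0) _ ⟩
  (sumBelow g (suc p) + e 0) + (sumBelow g′ (J * suc p) + sumBelow (e ∘ suc) J)
    ≤⟨ +-mono-≤ first-block (sumBelow-blocks p (g≤h ∘ (suc p +_)) g′-last h′-last J) ⟩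
  sumBelow h (suc p) + sumBelow h′ (J * suc p)
    ≡⟨ sym (sumBelow-+ h (suc p) (J * suc p)) ⟩
  sumBelow h (suc p + J * suc p) ∎
  where
  open ≤-Reasoning
  g′ h′ : ℕ → ℕ
  g′ i = g (suc p + i)
  h′ i = h (suc p + i)

  g′-last : ∀ J → g′ (J * suc p + p) ≡ 0
  g′-last J = trans (cong g (sym (+-assoc (suc p) (J * suc p) p))) (g-last (suc J))

  h′-last : ∀ J → h′ (J * suc p + p) ≡ e (suc J)
  h′-last J = trans (cong h (sym (+-assoc (suc p) (J * suc p) p))) (h-last (suc J))

  first-block : sumBelow g (suc p) + e 0 ≤ sumBelow h (suc p)
  first-block = begin
    sumBelow g (suc p) + e 0   ≡⟨ cong₂ _+_ (sumBelow-suc g p) (sym (h-last 0)) ⟩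
    sumBelow g p + g p + h p   ≡⟨ cong (λ z → sumBelow g p + z + h p) (g-last 0) ⟩
    sumBelow g p + 0 + h p     ≤⟨ +-monoˡ-≤ (h p) (≤-reflexive (+-identityʳ _)) ⟩
    sumBelow g p + h p         ≤⟨ +-monoˡ-≤ (h p) (sumBelow-mono-≤ p g≤h) ⟩
    sumBelow h p + h p         ≡⟨ sym (sumBelow-suc h p) ⟩
    sumBelow h (suc p)         ∎

coprime-∣ʳ : n ∣ n′ → Coprime k n′ → Coprime k n
coprime-∣ʳ n∣n′ k⊥n′ (d∣k , d∣n) = k⊥n′ (d∣k , ∣-trans d∣n n∣n′)

coprime-∣ˡ : k ∣ k′ → Coprime k′ n → Coprime k n
coprime-∣ˡ k∣k′ k′⊥n = coprime-sym (coprime-∣ʳ k∣k′ (coprime-sym k′⊥n))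

coprime-*ʳ : Coprime k m → Coprime k n → Coprime k (m * n)
coprime-*ʳ k⊥m k⊥n (d∣k , d∣mn) = k⊥n (d∣k , coprime-divisor (λ (e∣d , e∣m) → k⊥m (∣-trans e∣d d∣k , e∣m)) d∣mn)

coprime-+⁻¹ : Coprime (n + k) n → Coprime k n
coprime-+⁻¹ n+k⊥n (d∣k , d∣n) = n+k⊥n (∣m∣n⇒∣m+n d∣n d∣k , d∣n)

prime∤⇒coprime : ∀ {p} → Prime p → ¬ p ∣ n → Coprime p n
prime∤⇒coprime p-prime p∤n (d∣p , d∣n) with prime⇒irreducible p-prime d∣p
... | inj₁ d≡1 = d≡1
... | inj₂ refl = contradiction d∣n p∤n

𝟙 : ∀ {a} {A : Set a} → Dec A → ℕ
𝟙 a? = if does a? then 1 else 0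

𝟙-mono : ∀ {a b} {A : Set a} {B : Set b} (a? : Dec A) (b? : Dec B) → (A → B) → 𝟙 a? ≤ 𝟙 b?
𝟙-mono (no _)  _       _   = z≤n
𝟙-mono (yes _) (yes _) _   = ≤-refl
𝟙-mono (yes a) (no ¬b) A⇒B = contradiction (A⇒B a) ¬b

𝟙-≡0 : ∀ {a} {A : Set a} (a? : Dec A) → ¬ A → 𝟙 a? ≡ 0
𝟙-≡0 (yes a) ¬a = contradiction a ¬a
𝟙-≡0 (no _)  ¬a = refl

length-filter-applyUpTo : ∀ {p} {P : Pred ℕ p} (P? : Decidable P) f L →
  length (filter P? (applyUpTo f L)) ≡ sumBelow (𝟙 ∘ P? ∘ f) L
length-filter-applyUpTo P? f zero = refl
length-filter-applyUpTo P? f (suc L) with does (P? (f 0))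
... | true  = cong suc (length-filter-applyUpTo P? (f ∘ suc) L)
... | false = length-filter-applyUpTo P? (f ∘ suc) L

-- Opaque so that k and n can be recovered from 𝟙-coprime k n by unification.
opaque
  𝟙-coprime : ℕ → ℕ → ℕ
  𝟙-coprime k n = 𝟙 (gcd k n ≟ 1)

  𝟙-coprime-mono : (Coprime k n → Coprime k′ n′) → 𝟙-coprime k n ≤ 𝟙-coprime k′ n′
  𝟙-coprime-mono {k} {n} {k′} {n′} ⊥⇒⊥ = 𝟙-mono (gcd k n ≟ 1) (gcd k′ n′ ≟ 1) (coprime⇒gcd≡1 ∘ ⊥⇒⊥ ∘ gcd≡1⇒coprime)

  ¬coprime⇒𝟙-coprime≡0 : ¬ Coprime k n → 𝟙-coprime k n ≡ 0
  ¬coprime⇒𝟙-coprime≡0 {k} {n} ¬k⊥n = 𝟙-≡0 (gcd k n ≟ 1) (¬k⊥n ∘ gcd≡1⇒coprime)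

𝟙-coprime-cong : (Coprime k n → Coprime k′ n′) → (Coprime k′ n′ → Coprime k n) →
  𝟙-coprime k n ≡ 𝟙-coprime k′ n′
𝟙-coprime-cong ⇒ ⇐ = ≤-antisym (𝟙-coprime-mono ⇒) (𝟙-coprime-mono ⇐)

coprimesUpTo : ℕ → ℕ → ℕ
coprimesUpTo n = sumBelow (λ i → 𝟙-coprime (suc i) n)

opaque
  unfolding 𝟙-coprime

  φ≡coprimesUpTo : ∀ n → φ n ≡ coprimesUpTo n n
  φ≡coprimesUpTo n = trans (cong (length ∘ filter (λ k → gcd k n ≟ 1)) (map-upTo suc n))
                           (length-filter-applyUpTo (λ k → gcd k n ≟ 1) suc n)

coprimesUpTo-periodic : ∀ n y → coprimesUpTo n (y * n) ≡ y * φ n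
coprimesUpTo-periodic n y = trans (sumBelow-periodic _ n shift y) (cong (y *_) (sym (φ≡coprimesUpTo n)))
  where
  shift : ∀ i → 𝟙-coprime (suc (n + i)) n ≡ 𝟙-coprime (suc i) n
  shift i rewrite sym (+-suc n i) = 𝟙-coprime-cong coprime-+⁻¹ coprime-+

coprimesUpTo-anti-∣ : ∀ L → m ∣ n → coprimesUpTo n L ≤ coprimesUpTo m L
coprimesUpTo-anti-∣ L m∣n = sumBelow-mono-≤ L (λ i → 𝟙-coprime-mono (coprime-∣ʳ m∣n))

coprimesUpTo-*-∣ : ∀ L → q ∣ n → coprimesUpTo (q * n) L ≡ coprimesUpTo n L
coprimesUpTo-*-∣ {q} L q∣n = sumBelow-cong L λ i →
  𝟙-coprime-cong (coprime-∣ʳ (n∣m*n q)) (λ k⊥n → coprime-*ʳ (coprime-∣ʳ q∣n k⊥n) k⊥n)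

φ-*-≤ : ∀ y n → φ (y * n) ≤ y * φ n
φ-*-≤ y n = begin
  φ (y * n)                    ≡⟨ φ≡coprimesUpTo (y * n) ⟩
  coprimesUpTo (y * n) (y * n) ≤⟨ coprimesUpTo-anti-∣ (y * n) (n∣m*n y) ⟩
  coprimesUpTo n (y * n)       ≡⟨ coprimesUpTo-periodic n y ⟩
  y * φ n                      ∎
  where open ≤-Reasoning

φ-*-∣ : ∀ q n → q ∣ n → φ (q * n) ≡ q * φ n
φ-*-∣ q n q∣n = begin
  φ (q * n)                    ≡⟨ φ≡coprimesUpTo (q * n) ⟩
  coprimesUpTo (q * n) (q * n) ≡⟨ coprimesUpTo-*-∣ (q * n) q∣n ⟩
  coprimesUpTo n (q * n)       ≡⟨ coprimesUpTo-periodic n q ⟩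
  q * φ n                      ∎
  where open ≡-Reasoning

φ-^-∣ : ∀ q c n → q ∣ n → φ (q ^ c * n) ≡ q ^ c * φ n
φ-^-∣ q zero    n q∣n = trans (cong φ (+-identityʳ n)) (sym (+-identityʳ (φ n)))
φ-^-∣ q (suc c) n q∣n = begin
  φ (q * q ^ c * n)   ≡⟨ cong φ (*-assoc q (q ^ c) n) ⟩
  φ (q * (q ^ c * n)) ≡⟨ φ-*-∣ q (q ^ c * n) (∣-trans q∣n (n∣m*n (q ^ c))) ⟩
  q * φ (q ^ c * n)   ≡⟨ cong (q *_) (φ-^-∣ q c n q∣n) ⟩
  q * (q ^ c * φ n)   ≡⟨ sym (*-assoc q (q ^ c) (φ n)) ⟩
  q * q ^ c * φ n     ∎
  where open ≡-Reasoning

-- Among 1, …, pn, those coprime to n but not to pn are the p j with j coprime to n, and each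
-- block of length p contains exactly one multiple of p, at its end.
φ-*-prime-≤ : ∀ p₁ n → Prime (suc p₁) → ¬ suc p₁ ∣ n → φ (suc p₁ * n) ≤ p₁ * φ n
φ-*-prime-≤ p₁ n p-prime p∤n = +-cancelˡ-≤ (φ n) _ _ (begin
  φ n + φ (p * n)                                 ≡⟨ +-comm (φ n) _ ⟩
  φ (p * n) + φ n                                 ≡⟨ cong₂ _+_ φ[pn]-as-count (φ≡coprimesUpTo n) ⟩
  coprimesUpTo (p * n) (n * p) + coprimesUpTo n n ≤⟨ sumBelow-blocks p₁ coprime-pn⇒n multiple-last coprime-last n ⟩
  coprimesUpTo n (n * p)                          ≡⟨ cong (coprimesUpTo n) (*-comm n p) ⟩
  coprimesUpTo n (p * n)                          ≡⟨ coprimesUpTo-periodic n p ⟩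
  φ n + p₁ * φ n                                  ∎)
  where
  open ≤-Reasoning
  p : ℕ
  p = suc p₁

  φ[pn]-as-count : φ (p * n) ≡ coprimesUpTo (p * n) (n * p)
  φ[pn]-as-count = trans (φ≡coprimesUpTo (p * n)) (cong (coprimesUpTo (p * n)) (*-comm p n))

  coprime-pn⇒n : ∀ i → 𝟙-coprime (suc i) (p * n) ≤ 𝟙-coprime (suc i) n
  coprime-pn⇒n i = 𝟙-coprime-mono (coprime-∣ʳ (n∣m*n p))

  block-end : ∀ J → suc (J * p + p₁) ≡ suc J * p
  block-end J = trans (sym (+-suc (J * p) p₁)) (+-comm (J * p) p)

  multiple-last : ∀ J → 𝟙-coprime (suc (J * p + p₁)) (p * n) ≡ 0
  multiple-last J = ¬coprime⇒𝟙-coprime≡0 λ ⊥pn →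
    nonTrivial⇒≢1 {{prime⇒nonTrivial p-prime}} (⊥pn (subst (p ∣_) (sym (block-end J)) (n∣m*n (suc J)) , m∣m*n n))

  coprime-last : ∀ J → 𝟙-coprime (suc (J * p + p₁)) n ≡ 𝟙-coprime (suc J) n
  coprime-last J rewrite block-end J = 𝟙-coprime-cong (coprime-∣ˡ (m∣m*n p))
    (λ J+1⊥n → coprime-sym (coprime-*ʳ (coprime-sym J+1⊥n) (coprime-sym (prime∤⇒coprime p-prime p∤n))))

n<m^n : 1 < m → ∀ n → n < m ^ n
n<m^n 1<m zero    = z<s
n<m^n {m} 1<m (suc n) = begin-strict
  suc n           ≤⟨ n<m^n 1<m n ⟩
  m ^ n           <⟨ m<m+n (m ^ n) (≤-trans z<s (n<m^n 1<m n)) ⟩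
  m ^ n + m ^ n   ≡⟨ cong (m ^ n +_) (sym (+-identityʳ (m ^ n))) ⟩
  2 * m ^ n       ≤⟨ *-monoˡ-≤ (m ^ n) 1<m ⟩
  m * m ^ n       ∎
  where open ≤-Reasoning

consecutive-multiples-around : ∀ d Q → d * d ≤ Q → ∃[ y ] (y * d ≤ Q × Q < y * suc d)
consecutive-multiples-around zero Q _ =
  suc Q , ≤-trans (≤-reflexive (*-zeroʳ (suc Q))) z≤n , ≤-reflexive (sym (*-identityʳ (suc Q)))
consecutive-multiples-around d@(suc _) Q d*d≤Q = Q / d , m/n*n≤m Q d , (begin-strict
  Q                   ≡⟨ m≡m%n+[m/n]*n Q d ⟩
  Q % d + Q / d * d   <⟨ +-monoˡ-< (Q / d * d) (<-≤-trans (m%n<n Q d) d≤Q/d) ⟩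
  Q / d + Q / d * d   ≡⟨ sym (*-suc (Q / d) d) ⟩
  Q / d * suc d       ∎)
  where
  open ≤-Reasoning
  d≤Q/d : d ≤ Q / d
  d≤Q/d = subst (_≤ Q / d) (m*n/n≡m d d) (/-monoˡ-≤ d d*d≤Q)

exceeded-by-larger-with-φ≤ : ∀ p₁ q c K .{{_ : NonZero K}} → Prime (suc p₁) → ¬ suc p₁ ∣ K → q ∣ K →
  p₁ * p₁ ≤ q ^ c → ∃[ x ] (q ^ c * K < x × φ x ≤ φ (q ^ c * K))
exceeded-by-larger-with-φ≤ p₁ q c K p-prime p∤K q∣K p₁²≤Q
  with consecutive-multiples-around p₁ (q ^ c) p₁²≤Q
... | y , y*p₁≤Q , Q<y*p = y * (p * K) , Q*K<x , φx≤φ[Q*K]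
  where
  p : ℕ
  p = suc p₁
  Q*K<x : q ^ c * K < y * (p * K)
  Q*K<x = <-≤-trans (*-monoˡ-< K Q<y*p) (≤-reflexive (*-assoc y p K))

  φx≤φ[Q*K] : φ (y * (p * K)) ≤ φ (q ^ c * K)
  φx≤φ[Q*K] = begin
    φ (y * (p * K))  ≤⟨ φ-*-≤ y (p * K) ⟩
    y * φ (p * K)    ≤⟨ *-monoʳ-≤ y (φ-*-prime-≤ p₁ K p-prime p∤K) ⟩
    y * (p₁ * φ K)   ≡⟨ sym (*-assoc y p₁ (φ K)) ⟩
    y * p₁ * φ K     ≤⟨ *-monoˡ-≤ (φ K) y*p₁≤Q ⟩
    q ^ c * φ K      ≡⟨ sym (φ-^-∣ q c K q∣K) ⟩
    φ (q ^ c * K)    ∎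
    where open ≤-Reasoning

^-monoʳ-∣ : ∀ q → m ≤ n → q ^ m ∣ q ^ n
^-monoʳ-∣ {m} q m≤n with m≤n⇒∃[o]m+o≡n m≤n
... | o , refl = divides (q ^ o) (trans (^-distribˡ-+-* q m o) (*-comm (q ^ m) (q ^ o)))

^-suc-∣⇒∃ : ∀ q c → q ^ suc c ∣ n → ∃[ K ] (n ≡ q ^ c * K × q ∣ K)
^-suc-∣⇒∃ q c (divides t refl) = q * t , eq , m∣m*n t
  where
  open ≡-Reasoning
  eq : t * (q * q ^ c) ≡ q ^ c * (q * t)
  eq = begin
    t * (q * q ^ c) ≡⟨ *-comm t _ ⟩
    q * q ^ c * t   ≡⟨ cong (_* t) (*-comm q (q ^ c)) ⟩
    q ^ c * q * t   ≡⟨ *-assoc (q ^ c) q t ⟩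
    q ^ c * (q * t) ∎

IsValuation⇒NonZero : ∀ {q n r} → IsValuation q n r → NonZero n
IsValuation⇒NonZero {q} {zero} {r} (_ , r-max) = contradiction (r-max (suc r) ((q ^ suc r) ∣0)) 1+n≰n
IsValuation⇒NonZero {n = suc _}    _           = _

IsN₁⇒¬q^[1+p₁²]∣ : ∀ {m N} p₁ q → IsN₁ m N → .{{NonZero N}} → Prime (suc p₁) → ¬ suc p₁ ∣ N → 1 < q →
  ¬ q ^ suc (p₁ * p₁) ∣ N
IsN₁⇒¬q^[1+p₁²]∣ p₁ q (φN≤m , N-max) p-prime p∤N 1<q q^[1+p₁²]∣N
  with ^-suc-∣⇒∃ q (p₁ * p₁) q^[1+p₁²]∣N
... | K , refl , q∣K
  with exceeded-by-larger-with-φ≤ p₁ q (p₁ * p₁) K {{m*n≢0⇒n≢0 (q ^ (p₁ * p₁))}} p-prime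
         (p∤N ∘ λ p∣K → ∣-trans p∣K (n∣m*n (q ^ (p₁ * p₁)))) q∣K (<⇒≤ (n<m^n 1<q (p₁ * p₁)))
... | x , N<x , φx≤φN = contradiction (N-max x (≤-trans φx≤φN φN≤m)) (<⇒≱ N<x)

proposition2 : ∀ (q p : ℕ) → Prime q → Prime p → q < p →
    ∃[ D ] (∀ N → InN₁ N → (∀ ℓ → Prime ℓ → ℓ ∣ N → ℓ < p) →
    ∀ r → IsValuation q N r → r ≤ D)
proposition2 q zero     _       p-prime _ = contradiction refl (≢-nonZero⁻¹ 0 {{prime⇒nonZero p-prime}})
proposition2 q (suc p₁) q-prime p-prime _ = p₁ * p₁ , bound
  where
  bound : ∀ N → InN₁ N → (∀ ℓ → Prime ℓ → ℓ ∣ N → ℓ < suc p₁) → ∀ r → IsValuation q N r → r ≤ p₁ * p₁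
  bound N (_ , _ , N-is-N₁) primes<p r v@(q^r∣N , _) = ≮⇒≥ λ p₁²<r →
    IsN₁⇒¬q^[1+p₁²]∣ p₁ q N-is-N₁ {{IsValuation⇒NonZero v}} p-prime
      (λ p∣N → <-irrefl refl (primes<p (suc p₁) p-prime p∣N))
      (nonTrivial⇒n>1 q {{prime⇒nonTrivial q-prime}})
      (∣-trans (^-monoʳ-∣ q p₁²<r) q^r∣N)
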